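{- A connected graph $G$ satisfies $\operatorname{cdim}(G)=1$ if and only if $G$ is (isomorphic to) $K_2$.
   Context: All graphs are nonempty, finite, simple and undirected. For distinct vertices $v,w$ of a graph $G$, $\kappa(v,w)$ denotes the maximum number of internally vertex-disjoint $v$–$w$ paths in $G$; by convention $\kappa(v,v)=\infty$. For an ordered vertex set $W=\{w_1,\ldots,w_k\}\subseteq V(G)$, the connectivity representation of $v$ is $r(v,W)=[\kappa(v,w_1),\ldots,\kappa(v,w_k)]$. $W$ is resolving for $G$ if $r(v_1,W)=r(v_2,W)$ implies $v_1=v_2$ for all $v_1,v_2\in V(G)$. The connectivity dimension $\operatorname{cdim}(G)$ is the minimum cardinality of a resolving set of $G$. -}

module Defs where

open import Data.Nat using (ℕ; zero; suc; _<_)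
open import Data.Fin using (Fin)
open import Data.List using (List; []; _∷_)
open import Data.List.Membership.Propositional using (_∈_)
open import Data.List.Relation.Unary.Unique.Propositional using (Unique)
open import Data.Product using (Σ; _×_; ∃)
open import Data.Empty using (⊥)
open import Relation.Nullary using (¬_)
open import Relation.Binary.PropositionalEquality using (_≡_; _≢_)
open import Function.Bundles using (_⇔_; _↔_; Inverse)

record Graph (n : ℕ) : Set₁ where
  field
    Adj   : Fin n → Fin n → Set
    sym   : ∀ {u v} → Adj u v → Adj v u
    irrefl : ∀ {u} → ¬ Adj u u
open Graph public

module _ {n : ℕ} (G : Graph n) where

  data Walk : Fin n → Fin n → Set where
    edge : ∀ {u v} → Adj G u v → Walk u v
    cons : ∀ {u v w} → Adj G u v → Walk v w → Walk u w

  verts : ∀ {u w} → Walk u w → List (Fin n)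
  verts {u} {w} (edge _)   = u ∷ w ∷ []
  verts {u}     (cons _ p) = u ∷ verts p

  interior : ∀ {u w} → Walk u w → List (Fin n)
  interior (edge _)          = []
  interior (cons {v = v} _ p) = v ∷ interior p

  IsPath : ∀ {u w} → Walk u w → Set
  IsPath p = Unique (verts p)

  DisjointPaths : Fin n → Fin n → ℕ → Set
  DisjointPaths v w k =
    Σ (Fin k → Walk v w) λ P →
      (∀ i → IsPath (P i)) ×
      (∀ i j → i ≢ j → verts (P i) ≢ verts (P j)) ×
      (∀ i j → i ≢ j → ∀ x → x ∈ interior (P i) → x ∈ interior (P j) → ⊥)

  Connected : Set
  Connected = ∀ u v → u ≢ v → Walk u v

data ℕ∞ : Set where
  fin : ℕ → ℕ∞
  ∞   : ℕ∞

module _ {n : ℕ} (G : Graph n) where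

  data IsKappa : Fin n → Fin n → ℕ∞ → Set where
    kappa-refl : ∀ {v} → IsKappa v v ∞
    kappa-max  : ∀ {v w k} → v ≢ w → DisjointPaths G v w k →
                 ¬ DisjointPaths G v w (suc k) → IsKappa v w (fin k)

  SameRep : ∀ {k} → (Fin k → Fin n) → Fin n → Fin n → Set
  SameRep W v₁ v₂ = ∀ i → ∃ λ c → IsKappa v₁ (W i) c × IsKappa v₂ (W i) c

  Resolving : ∀ {k} → (Fin k → Fin n) → Set
  Resolving W = ∀ v₁ v₂ → SameRep W v₁ v₂ → v₁ ≡ v₂

  -- an ordered vertex set of size k: an injective k-tuple of vertices
  InjectiveTuple : ∀ {k} → (Fin k → Fin n) → Set
  InjectiveTuple W = ∀ i j → W i ≡ W j → i ≡ j

  HasCdim : ℕ → Set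
  HasCdim d =
    (Σ (Fin d → Fin n) λ W → InjectiveTuple W × Resolving W) ×
    (∀ k → k < d → (W : Fin k → Fin n) → InjectiveTuple W → ¬ Resolving W)

_≅_ : ∀ {n m} → Graph n → Graph m → Set
_≅_ {n} {m} G H =
  Σ (Fin n ↔ Fin m) λ f →
    ∀ u v → (Adj G u v ⇔ Adj H (Inverse.to f u) (Inverse.to f v))

K₂ : Graph 2
K₂ = record { Adj = λ u v → u ≢ v ; sym = λ p q → p (Relation.Binary.PropositionalEquality.sym q) ; irrefl = λ p → p Relation.Binary.PropositionalEquality.refl }

-- Let G have n + 1 ≥ 3 vertices and suppose {a} resolves G.  The n vertices v ≠ a then have
-- pairwise distinct values κ(v, a), all in {1, …, n}: a v–a path exists by connectivity, and
-- the second vertices of disjoint v–a paths are distinct neighbours of v.  So some u has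
-- κ(u, a) = n, which forces u and a to be adjacent to every other vertex, and some x ≠ u has
-- κ(x, a) = 1; but x–a and x–u–a are two disjoint paths.  DisjointPaths is not decidable
-- here, so the values κ(v, a) exist only under double negation, which suffices for ⊥.
module Submission where

open import Defs hiding (sym)
open import Data.Nat using (ℕ; zero; suc; _+_; _≤_; _<_; z≤n; s≤s)
open import Data.Nat.Properties using (1+n≰n; n<1+n; 0≢1+n)
open import Data.Fin as Fin using (Fin; zero; suc; punchIn; punchOut; fromℕ<)
open import Data.Fin.Properties
  using (punchInᵢ≢i; punchIn-injective; punchOut-injective; injective⇒≤; fromℕ<-injective; any?)
open import Data.List using ([]; _∷_; length)
open import Data.List.Membership.Propositional using (_∈_; _∉_)
open import Data.List.Relation.Unary.Any using (here; there)
open import Data.List.Relation.Unary.All as All using ([]; _∷_)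
open import Data.List.Relation.Unary.All.Properties.Core using (¬Any⇒All¬)
open import Data.List.Relation.Unary.AllPairs using ([]; _∷_)
open import Data.Product using (Σ; ∃; _×_; _,_; proj₁; proj₂)
open import Data.Sum using (_⊎_; inj₁; inj₂)
open import Data.Empty using (⊥; ⊥-elim)
open import Function using (_∘_)
open import Function.Bundles using (_⇔_; mk⇔; _↔_; Inverse; Injection)
open import Function.Properties.Inverse using (Inverse⇒Injection)
open import Function.Construct.Identity using (↔-id)
open import Function.Definitions using (Injective; StrictlySurjective)
open import Relation.Nullary using (¬_; yes; no; contradiction)
open import Relation.Nullary.Decidable using (¬¬-excluded-middle)
open import Relation.Nullary.Negation using (¬¬-map)
open import Relation.Binary.PropositionalEquality using (_≡_; _≢_; refl; sym; trans; cong; subst)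

private variable
  n k : ℕ

module _ {n k} {c : Fin (suc n)} {f : Fin k → Fin (suc n)}
         (c∉f : ∀ i → c ≢ f i) (f-inj : Injective _≡_ _≡_ f) where

  punchOut-avoiding-injective : Injective _≡_ _≡_ (λ i → punchOut (c∉f i))
  punchOut-avoiding-injective eq = f-inj (punchOut-injective (c∉f _) (c∉f _) eq)

  avoiding-injective⇒≤ : k ≤ n
  avoiding-injective⇒≤ = injective⇒≤ punchOut-avoiding-injective

injective⇒strictlySurjective : (f : Fin n → Fin n) → Injective _≡_ _≡_ f → StrictlySurjective _≡_ f
injective⇒strictlySurjective {suc n} f f-inj y with any? (λ x → f x Fin.≟ y)
... | yes hit = hit
... | no miss = contradiction (avoiding-injective⇒≤ (λ x y≡fx → miss (x , sym y≡fx)) f-inj) 1+n≰n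

avoiding-injective⇒onto : {c : Fin (suc n)} {f : Fin n → Fin (suc n)} →
                          (c∉f : ∀ i → c ≢ f i) → Injective _≡_ _≡_ f →
                          ∀ y → c ≢ y → ∃ λ i → f i ≡ y
avoiding-injective⇒onto c∉f f-inj y c≢y
  with i , eq ← injective⇒strictlySurjective _ (punchOut-avoiding-injective c∉f f-inj) (punchOut c≢y)
  = i , punchOut-injective (c∉f i) c≢y eq

Fin2-other-unique : {x y z : Fin 2} → x ≢ y → z ≢ y → x ≡ z
Fin2-other-unique {zero}     {zero}     x≢y _   = contradiction refl x≢y
Fin2-other-unique {zero}     {suc zero} {zero}     _ _   = refl
Fin2-other-unique {zero}     {suc zero} {suc zero} _ z≢y = contradiction refl z≢y
Fin2-other-unique {suc zero} {zero}     {zero}     _ z≢y = contradiction refl z≢y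
Fin2-other-unique {suc zero} {zero}     {suc zero} _ _   = refl
Fin2-other-unique {suc zero} {suc zero} x≢y _   = contradiction refl x≢y

¬¬-lastTrue : (P : ℕ → Set) → P 0 → ∀ N → ¬ P N → ¬ ¬ (∃ λ k → P k × ¬ P (suc k))
¬¬-lastTrue P p₀ zero    ¬p₀ = λ _ → ¬p₀ p₀
¬¬-lastTrue P p₀ (suc N) ¬pₙ ¬last = ¬¬-excluded-middle λ where
  (yes pₙ₋₁) → ¬last (N , pₙ₋₁ , ¬pₙ)
  (no ¬pₙ₋₁) → ¬¬-lastTrue P p₀ N ¬pₙ₋₁ ¬last

¬¬-pull : (Q : Fin n → Set) → (∀ i → ¬ ¬ Q i) → ¬ ¬ (∀ i → Q i)
¬¬-pull {zero}  Q _    ¬all = ¬all λ ()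
¬¬-pull {suc n} Q ¬¬Q ¬all = ¬¬Q zero λ q₀ → ¬¬-pull (Q ∘ suc) (¬¬Q ∘ suc) λ qₛ →
  ¬all λ { zero → q₀ ; (suc i) → qₛ i }

adj⇒≢ : (G : Graph n) {u v : Fin n} → Adj G u v → u ≢ v
adj⇒≢ G e refl = irrefl G e

Universal : Graph n → Fin n → Set
Universal G c = ∀ y → c ≢ y → Adj G c y

module Walks {n} (G : Graph n) where
  open import Data.List.Membership.DecPropositional (Fin._≟_ {n}) using (_∈?_)

  private variable
    u v w x : Fin n

  source∈verts : (p : Walk G u w) → u ∈ verts G p
  source∈verts (edge _)   = here refl
  source∈verts (cons _ _) = here refl

  target∈verts : (p : Walk G u w) → w ∈ verts G p
  target∈verts (edge _)   = there (here refl)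
  target∈verts (cons _ p) = there (target∈verts p)

  interior⊆verts : (p : Walk G u w) → x ∈ interior G p → x ∈ verts G p
  interior⊆verts (cons _ p) (here refl) = there (source∈verts p)
  interior⊆verts (cons _ p) (there x∈) = there (interior⊆verts p x∈)

  source≢target : (p : Walk G u w) → IsPath G p → u ≢ w
  source≢target (edge _)   ((u≢w ∷ []) ∷ _) = u≢w
  source≢target (cons _ p) (u∉p ∷ _)        = All.lookup u∉p (target∈verts p)

  source∉interior : (p : Walk G u w) → IsPath G p → u ∉ interior G p
  source∉interior (cons _ p) (u∉p ∷ _) (here refl) = All.lookup u∉p (source∈verts p) refl
  source∉interior (cons _ p) (u∉p ∷ _) (there u∈) = All.lookup u∉p (interior⊆verts p u∈) refl

  target∉interior : (p : Walk G u w) → IsPath G p → w ∉ interior G p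
  target∉interior (cons _ p) (_ ∷ p-path) (here refl) = source≢target p p-path refl
  target∉interior (cons _ p) (_ ∷ p-path) (there w∈) = target∉interior p p-path w∈

  suffixPath : (p : Walk G u w) → IsPath G p → x ∈ verts G p → x ≢ w → Σ (Walk G x w) (IsPath G)
  suffixPath (edge e)   p-path (here refl)         _   = edge e , p-path
  suffixPath (edge _)   _      (there (here refl)) x≢w = contradiction refl x≢w
  suffixPath (cons e p) p-path (here refl)         _   = cons e p , p-path
  suffixPath (cons _ p) (_ ∷ p-path) (there x∈)    x≢w = suffixPath p p-path x∈ x≢w

  walk⇒path : Walk G u w → u ≢ w → Σ (Walk G u w) (IsPath G)
  walk⇒path (edge e) u≢w = edge e , (u≢w ∷ []) ∷ [] ∷ []
  walk⇒path {u} {w} (cons {v = v} e p) u≢w with v Fin.≟ w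
  ... | yes refl = edge e , (u≢w ∷ []) ∷ [] ∷ []
  ... | no v≢w with walk⇒path p v≢w
  ...   | q , q-path with u ∈? verts G q
  ...     | yes u∈q = suffixPath q q-path u∈q u≢w
  ...     | no  u∉q = cons e q , ¬Any⇒All¬ (verts G q) u∉q ∷ q-path

  secondVertex : Walk G u w → Fin n
  secondVertex (edge {v = w} _)   = w
  secondVertex (cons {v = v} _ _) = v

  secondVertex-adj : (p : Walk G u w) → Adj G u (secondVertex p)
  secondVertex-adj (edge e)   = e
  secondVertex-adj (cons e _) = e

  secondVertex-location : (p : Walk G u w) →
    (secondVertex p ≡ w × verts G p ≡ u ∷ w ∷ []) ⊎ secondVertex p ∈ interior G p
  secondVertex-location (edge _)   = inj₁ (refl , refl)
  secondVertex-location (cons _ _) = inj₂ (here refl)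

  penultimateVertex : Walk G u w → Fin n
  penultimateVertex (edge {u} _) = u
  penultimateVertex (cons _ p)   = penultimateVertex p

  penultimateVertex-adj : (p : Walk G u w) → Adj G (penultimateVertex p) w
  penultimateVertex-adj (edge e)   = e
  penultimateVertex-adj (cons _ p) = penultimateVertex-adj p

  penultimateVertex-location : (p : Walk G u w) →
    (penultimateVertex p ≡ u × verts G p ≡ u ∷ w ∷ []) ⊎ penultimateVertex p ∈ interior G p
  penultimateVertex-location (edge _) = inj₁ (refl , refl)
  penultimateVertex-location (cons _ p) with penultimateVertex-location p
  ... | inj₁ (≡v , _) = inj₂ (here ≡v)
  ... | inj₂ ∈p       = inj₂ (there ∈p)

module _ {n} {G : Graph n} where
  open Walks G

  private variable
    s t u x y : Fin n

  connected⇒disjointPaths₁ : Connected G → s ≢ t → DisjointPaths G s t 1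
  connected⇒disjointPaths₁ conn s≢t with p , p-path ← walk⇒path (conn _ _ s≢t) s≢t =
    (λ _ → p) , (λ _ → p-path) , (λ { zero zero 0≢0 → contradiction refl 0≢0 })
              , (λ { zero zero 0≢0 → contradiction refl 0≢0 })

  triangle⇒disjointPaths₂ : Adj G x y → Adj G x u → Adj G u y → DisjointPaths G x y 2
  triangle⇒disjointPaths₂ {x = x} {y = y} xy xu uy = P , P-path , P-distinct , P-disjoint
    where
      P : Fin 2 → Walk G x y
      P zero       = edge xy
      P (suc zero) = cons xu (edge uy)

      P-path : ∀ i → IsPath G (P i)
      P-path zero       = (adj⇒≢ G xy ∷ []) ∷ [] ∷ []
      P-path (suc zero) = (adj⇒≢ G xu ∷ adj⇒≢ G xy ∷ []) ∷ (adj⇒≢ G uy ∷ []) ∷ [] ∷ []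

      P-distinct : ∀ i j → i ≢ j → verts G (P i) ≢ verts G (P j)
      P-distinct zero       zero       i≢j _  = i≢j refl
      P-distinct zero       (suc zero) _   eq with () ← cong length eq
      P-distinct (suc zero) zero       _   eq with () ← cong length eq
      P-distinct (suc zero) (suc zero) i≢j _  = i≢j refl

      P-disjoint : ∀ i j → i ≢ j → ∀ z → z ∈ interior G (P i) → z ∈ interior G (P j) → ⊥
      P-disjoint zero       _          _   _ ()
      P-disjoint (suc zero) zero       _   _ _ ()
      P-disjoint (suc zero) (suc zero) i≢j _ _ _ = i≢j refl

  module _ {k} (D : DisjointPaths G s t k) where
    private
      P = proj₁ D
      P-path = proj₁ (proj₂ D)
      P-distinct = proj₁ (proj₂ (proj₂ D))
      P-disjoint = proj₂ (proj₂ (proj₂ D))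

    -- A selected vertex is either an interior vertex of its path, or the endpoint e of a
    -- one-edge path; interiors are disjoint, avoid e, and there is only one one-edge path.
    selection-injective : (e : Fin n) (sel : Fin k → Fin n) → (∀ i → e ∉ interior G (P i)) →
      (∀ i → (sel i ≡ e × verts G (P i) ≡ s ∷ t ∷ []) ⊎ sel i ∈ interior G (P i)) →
      Injective _≡_ _≡_ sel
    selection-injective e sel e∉P location {i} {j} eq with i Fin.≟ j
    ... | yes i≡j = i≡j
    ... | no i≢j with location i | location j
    ...   | inj₁ (_ , edgeᵢ) | inj₁ (_ , edgeⱼ) =
      contradiction (trans edgeᵢ (sym edgeⱼ)) (P-distinct i j i≢j)
    ...   | inj₁ (≡e , _) | inj₂ ∈Pⱼ =
      contradiction (subst (_∈ _) (trans (sym eq) ≡e) ∈Pⱼ) (e∉P j)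
    ...   | inj₂ ∈Pᵢ | inj₁ (≡e , _) =
      contradiction (subst (_∈ _) (trans eq ≡e) ∈Pᵢ) (e∉P i)
    ...   | inj₂ ∈Pᵢ | inj₂ ∈Pⱼ =
      ⊥-elim (P-disjoint i j i≢j _ ∈Pᵢ (subst (_∈ _) (sym eq) ∈Pⱼ))

    secondVertices-injective : Injective _≡_ _≡_ (secondVertex ∘ P)
    secondVertices-injective = selection-injective t _
      (λ i → target∉interior (P i) (P-path i)) (secondVertex-location ∘ P)

    penultimateVertices-injective : Injective _≡_ _≡_ (penultimateVertex ∘ P)
    penultimateVertices-injective = selection-injective s _
      (λ i → source∉interior (P i) (P-path i)) (penultimateVertex-location ∘ P)

module _ {n} {G : Graph (suc n)} {s t : Fin (suc n)} where
  open Walks G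

  private
    second-avoids-source : ∀ {k} (D : DisjointPaths G s t k) i → s ≢ secondVertex (proj₁ D i)
    second-avoids-source D i = adj⇒≢ G (secondVertex-adj (proj₁ D i))

    penultimate-avoids-target : ∀ {k} (D : DisjointPaths G s t k) i → t ≢ penultimateVertex (proj₁ D i)
    penultimate-avoids-target D i = adj⇒≢ G (Graph.sym G (penultimateVertex-adj (proj₁ D i)))

  disjointPaths-≤ : ∀ {k} → DisjointPaths G s t k → k ≤ n
  disjointPaths-≤ D = avoiding-injective⇒≤ (second-avoids-source D) (secondVertices-injective D)

  disjointPaths-max⇒source-universal : DisjointPaths G s t n → Universal G s
  disjointPaths-max⇒source-universal D y s≢y
    with i , refl ← avoiding-injective⇒onto (second-avoids-source D) (secondVertices-injective D) y s≢y
    = secondVertex-adj (proj₁ D i)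

  disjointPaths-max⇒target-universal : DisjointPaths G s t n → Universal G t
  disjointPaths-max⇒target-universal D y t≢y
    with i , refl ← avoiding-injective⇒onto (penultimate-avoids-target D)
                                            (penultimateVertices-injective D) y t≢y
    = Graph.sym G (penultimateVertex-adj (proj₁ D i))

module _ {n} {G : Graph n} {v w : Fin n} where

  IsKappa-∞⇒≡ : IsKappa G v w ∞ → v ≡ w
  IsKappa-∞⇒≡ kappa-refl = refl

  IsKappa-fin⇒≢ : IsKappa G v w (fin k) → v ≢ w
  IsKappa-fin⇒≢ (kappa-max v≢w _ _) = v≢w

  IsKappa-paths : IsKappa G v w (fin k) → DisjointPaths G v w k
  IsKappa-paths (kappa-max _ D _) = D

  IsKappa-maximal : IsKappa G v w (fin k) → ¬ DisjointPaths G v w (suc k)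
  IsKappa-maximal (kappa-max _ _ ¬D) = ¬D

¬¬-IsKappa-positive : {G : Graph (suc n)} {v w : Fin (suc n)} → Connected G → v ≢ w →
                      ¬ ¬ (∃ λ k → IsKappa G v w (fin (suc k)))
¬¬-IsKappa-positive {n} {G} {v} {w} conn v≢w =
  ¬¬-map (λ (k , D , ¬D) → k , kappa-max v≢w D ¬D)
    (¬¬-lastTrue (DisjointPaths G v w ∘ suc) (connected⇒disjointPaths₁ conn v≢w) n
                 (λ D → 1+n≰n (disjointPaths-≤ D)))

resolving-singleton : {G : Graph n} {W : Fin 1 → Fin n} {v₁ v₂ : Fin n} {c : ℕ∞} → Resolving G W →
                      IsKappa G v₁ (W zero) c → IsKappa G v₂ (W zero) c → v₁ ≡ v₂
resolving-singleton res κ₁ κ₂ = res _ _ λ { zero → _ , κ₁ , κ₂ }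

module _ {m} {G : Graph (3 + m)} {W : Fin 1 → Fin (3 + m)} where
  private
    a : Fin (3 + m)
    a = W zero

    v : Fin (2 + m) → Fin (3 + m)
    v = punchIn a

    v≢a : ∀ i → v i ≢ a
    v≢a = punchInᵢ≢i a

  -- κ i = (k , _) says κ(v i, a) = k + 1, so k < n and the k are a permutation of 0, …, n - 1.
  module _ (res : Resolving G W) (κ : ∀ i → ∃ λ k → IsKappa G (v i) a (fin (suc k))) where
    private
      κ-at : ∀ {i k} → proj₁ (κ i) ≡ k → IsKappa G (v i) a (fin (suc k))
      κ-at refl = proj₂ (κ _)

      κ<n : ∀ i → proj₁ (κ i) < 2 + m
      κ<n i = disjointPaths-≤ (IsKappa-paths (proj₂ (κ i)))

      κ-index : Fin (2 + m) → Fin (2 + m)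
      κ-index i = fromℕ< (κ<n i)

      κ-index-injective : Injective _≡_ _≡_ κ-index
      κ-index-injective {i} {j} eq = punchIn-injective a i j
        (resolving-singleton res (proj₂ (κ i)) (κ-at (sym (fromℕ<-injective _ _ (κ<n i) (κ<n j) eq))))

      κ-attained : ∀ k → k < 2 + m → ∃ λ i → proj₁ (κ i) ≡ k
      κ-attained k k<
        with i , eq ← injective⇒strictlySurjective κ-index κ-index-injective (fromℕ< k<)
        = i , fromℕ<-injective _ _ (κ<n i) k< eq

    κ-extremes-contradict : ∀ {i₁ i₀} → proj₁ (κ i₁) ≡ suc m → proj₁ (κ i₀) ≡ 0 → ⊥
    κ-extremes-contradict {i₁} {i₀} κ₁≡n κ₀≡1 =
      IsKappa-maximal (κ-at κ₀≡1) (triangle⇒disjointPaths₂ xa xu ua)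
      where
        u-paths : DisjointPaths G (v i₁) a (2 + m)
        u-paths = IsKappa-paths (κ-at κ₁≡n)

        x≢u : v i₀ ≢ v i₁
        x≢u eq = 0≢1+n (trans (sym κ₀≡1) (trans (cong (proj₁ ∘ κ) (punchIn-injective a _ _ eq)) κ₁≡n))

        xa : Adj G (v i₀) a
        xa = Graph.sym G (disjointPaths-max⇒target-universal u-paths (v i₀) (v≢a i₀ ∘ sym))

        xu : Adj G (v i₀) (v i₁)
        xu = Graph.sym G (disjointPaths-max⇒source-universal u-paths (v i₀) (x≢u ∘ sym))

        ua : Adj G (v i₁) a
        ua = disjointPaths-max⇒source-universal u-paths a (v≢a i₁)

    resolving-contradicts-κ : ⊥
    resolving-contradicts-κ =
      κ-extremes-contradict (proj₂ (κ-attained (suc m) (n<1+n _))) (proj₂ (κ-attained 0 (s≤s z≤n)))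

  singleton-not-resolving : Connected G → ¬ Resolving G W
  singleton-not-resolving conn res =
    ¬¬-pull _ (λ i → ¬¬-IsKappa-positive conn (v≢a i)) (resolving-contradicts-κ res)

two-vertices⇒cdim1 : (G : Graph n) → Fin n ↔ Fin 2 → HasCdim G 1
two-vertices⇒cdim1 G φ = (W , W-injective , W-resolving) , nothing-smaller-resolves
  where
    open Inverse φ

    to-injective : Injective _≡_ _≡_ to
    to-injective = Injection.injective (Inverse⇒Injection φ)

    W : Fin 1 → Fin _
    W _ = from zero

    W-injective : InjectiveTuple G W
    W-injective zero zero _ = refl

    W-resolving : Resolving G W
    W-resolving v₁ v₂ same with same zero
    ... | ∞     , κ₁ , κ₂ = trans (IsKappa-∞⇒≡ κ₁) (sym (IsKappa-∞⇒≡ κ₂))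
    ... | fin _ , κ₁ , κ₂ =
      to-injective (Fin2-other-unique (IsKappa-fin⇒≢ κ₁ ∘ to-injective)
                                      (IsKappa-fin⇒≢ κ₂ ∘ to-injective))

    nothing-smaller-resolves : ∀ k → k < 1 → (W : Fin k → Fin _) →
                               InjectiveTuple G W → ¬ Resolving G W
    nothing-smaller-resolves zero _ _ _ res
      with () ← trans (sym (strictlyInverseˡ zero))
                      (trans (cong to (res (from zero) (from (suc zero)) λ ())) (strictlyInverseˡ (suc zero)))
    nothing-smaller-resolves (suc _) (s≤s ())

walk⇒adj-Fin2 : (G : Graph 2) {u v : Fin 2} → Walk G u v → u ≢ v → Adj G u v
walk⇒adj-Fin2 G (edge e)   _   = e
walk⇒adj-Fin2 G (cons e _) u≢v = subst (Adj G _) (Fin2-other-unique (adj⇒≢ G e ∘ sym) (u≢v ∘ sym)) e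

connected⇒≅K₂ : (G : Graph 2) → Connected G → G ≅ K₂
connected⇒≅K₂ G conn =
  ↔-id (Fin 2) , λ u v → mk⇔ (adj⇒≢ G) (λ u≢v → walk⇒adj-Fin2 G (conn u v u≢v) u≢v)

Graph1-resolved : (G : Graph 1) (W : Fin k → Fin 1) → Resolving G W
Graph1-resolved G W zero zero _ = refl

theorem2p2 : (n : ℕ) (G : Graph (suc n)) → Connected G →
    (HasCdim G 1 ⇔ (G ≅ K₂))
theorem2p2 zero G _ = mk⇔
  (λ (_ , minimal) → ⊥-elim (minimal 0 (s≤s z≤n) (λ ()) (λ ()) (Graph1-resolved G _)))
  (two-vertices⇒cdim1 G ∘ proj₁)
theorem2p2 (suc zero) G conn = mk⇔
  (λ _ → connected⇒≅K₂ G conn)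
  (two-vertices⇒cdim1 G ∘ proj₁)
theorem2p2 (suc (suc m)) G conn = mk⇔
  (λ ((_ , _ , resolving) , _) → ⊥-elim (singleton-not-resolving conn resolving))
  (two-vertices⇒cdim1 G ∘ proj₁)
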